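{- In $\mathsf{THS}_0$, for every thin class $X$: (1) $\mathrm{dom}(X)$ is thin; (2) for every function $F$, the class $F``X$ is thin and for every set $y\subseteq F``X$ there is a set $x\subseteq X$ with $y=F``x$; (3) $\bigcup X$ is a semiset (a subclass of some set).
   Context: $\mathsf{THS}_0$ is the first-order theory, in the language $\{\in\}$ whose objects are classes (sets being classes that are members of classes), with axioms: (Ext) classes with the same set-elements are equal; (Class) comprehension $\exists Y\forall y(y\in Y\leftrightarrow\Phi(y,\vec X))$ for arbitrary formulas $\Phi$; (Set) $\emptyset$ and $x\cup\{y\}$ are sets; (Ind) for set formulas $\varphi$ (quantifiers over sets only, no class variables): $\varphi(\emptyset)\wedge\forall x\forall y(\varphi(x)\wedge\varphi(y)\to\varphi(x\cup\{y\}))\to\forall x\varphi(x)$; (Thin) every thin class is a subclass of some set; (Comp) for every thin class $X$ and set $u\subseteq\bigcup X$ there is a set $x\subseteq X$ with $u\subseteq\bigcup x$. A class is small iff every subclass is a set; thin iff every subset is small. Pairs are Kuratowski pairs, $\mathrm{dom}$ is the domain, $F``A=\{b:\exists a\in A\,\langle a,b\rangle\in F\}$. -}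

module Defs where

open import Data.Nat using (ℕ; suc)
open import Data.Fin using (Fin)
open import Data.Vec using (Vec; _∷_; lookup)
open import Data.Vec.Relation.Unary.All using (All)
open import Data.Product using (Σ; _×_; _,_; ∃)
open import Data.Sum using (_⊎_)
open import Data.Empty using (⊥)
open import Data.Unit using (⊤)
open import Relation.Nullary using (¬_)
open import Relation.Binary.PropositionalEquality using (_≡_)
open import Function.Bundles using (_⇔_)

-- First-order formulas in the language {∈} (with equality),
-- de Bruijn-indexed; n = number of free variables.
-- Two kinds of quantifiers: over all classes (∀c, ∃c) and relativised
-- to sets (∀s, ∃s), i.e. ∀x (x is a set → …) / ∃x (x is a set ∧ …).

data Fm : ℕ → Set where
  _∈'_ _≐_       : ∀ {n} → Fin n → Fin n → Fm n
  ⊥'             : ∀ {n} → Fm n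
  _⇒_ _∧'_ _∨'_ : ∀ {n} → Fm n → Fm n → Fm n
  ∀c ∃c ∀s ∃s    : ∀ {n} → Fm (suc n) → Fm n

SetFm : ∀ {n} → Fm n → Set
SetFm (i ∈' j) = ⊤
SetFm (i ≐ j)  = ⊤
SetFm ⊥'       = ⊤
SetFm (φ ⇒ ψ)  = SetFm φ × SetFm ψ
SetFm (φ ∧' ψ) = SetFm φ × SetFm ψ
SetFm (φ ∨' ψ) = SetFm φ × SetFm ψ
SetFm (∀c φ)   = ⊥
SetFm (∃c φ)   = ⊥
SetFm (∀s φ)   = SetFm φ
SetFm (∃s φ)   = SetFm φ

module Notions {C : Set} (_∈_ : C → C → Set) where

  IsSet : C → Set
  IsSet x = Σ C λ Y → x ∈ Y

  _⊆_ : C → C → Set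
  A ⊆ B = ∀ z → z ∈ A → z ∈ B

  Small : C → Set
  Small X = ∀ Y → Y ⊆ X → IsSet Y

  Thin : C → Set
  Thin X = ∀ y → IsSet y → y ⊆ X → Small y

  Semiset : C → Set
  Semiset X = Σ C λ s → IsSet s × X ⊆ s

  IsEmpty : C → Set
  IsEmpty e = ∀ z → ¬ (z ∈ e)

  IsAdjoin : C → C → C → Set
  IsAdjoin w x y = ∀ z → z ∈ w ⇔ (z ∈ x ⊎ z ≡ y)

  _∈⋃_ : C → C → Set
  z ∈⋃ X = Σ C λ w → z ∈ w × w ∈ X

  IsUnion : C → C → Set
  IsUnion U X = ∀ z → z ∈ U ⇔ z ∈⋃ X

  -- Kuratowski pairs  p = {{a},{a,b}}
  IsSingleton : C → C → Set
  IsSingleton s a = ∀ z → z ∈ s ⇔ z ≡ a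

  IsDoubleton : C → C → C → Set
  IsDoubleton s a b = ∀ z → z ∈ s ⇔ (z ≡ a ⊎ z ≡ b)

  IsPair : C → C → C → Set
  IsPair p a b = ∀ z → z ∈ p ⇔ (IsSingleton z a ⊎ IsDoubleton z a b)

  PairIn : C → C → C → Set
  PairIn a b F = Σ C λ p → IsPair p a b × p ∈ F

  IsDom : C → C → Set
  IsDom D X = ∀ a → IsSet a → (a ∈ D ⇔ (Σ C λ b → IsSet b × PairIn a b X))

  IsFunction : C → Set
  IsFunction F =
    (∀ p → p ∈ F → Σ C λ a → Σ C λ b → IsSet a × IsSet b × IsPair p a b) ×
    (∀ a b b′ → IsSet a → IsSet b → IsSet b′ →
       PairIn a b F → PairIn a b′ F → b ≡ b′)

  IsImage : C → C → C → Set
  IsImage I F A =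
    ∀ b → IsSet b → (b ∈ I ⇔ (Σ C λ a → a ∈ A × IsSet a × PairIn a b F))

  Sat : ∀ {n} → Fm n → Vec C n → Set
  Sat (i ∈' j) ρ = lookup ρ i ∈ lookup ρ j
  Sat (i ≐ j)  ρ = lookup ρ i ≡ lookup ρ j
  Sat ⊥'       ρ = ⊥
  Sat (φ ⇒ ψ)  ρ = Sat φ ρ → Sat ψ ρ
  Sat (φ ∧' ψ) ρ = Sat φ ρ × Sat ψ ρ
  Sat (φ ∨' ψ) ρ = Sat φ ρ ⊎ Sat ψ ρ
  Sat (∀c φ)   ρ = ∀ x → Sat φ (x ∷ ρ)
  Sat (∃c φ)   ρ = Σ C λ x → Sat φ (x ∷ ρ)
  Sat (∀s φ)   ρ = ∀ x → IsSet x → Sat φ (x ∷ ρ)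
  Sat (∃s φ)   ρ = Σ C λ x → IsSet x × Sat φ (x ∷ ρ)

record THS₀-Model : Set₁ where
  field
    C   : Set
    _∈_ : C → C → Set
  open Notions _∈_
  field
    ext   : ∀ X Y → (∀ y → IsSet y → (y ∈ X ⇔ y ∈ Y)) → X ≡ Y
    class : ∀ {n} (Φ : Fm (suc n)) (ρ : Vec C n) →
            Σ C λ Y → ∀ y → IsSet y → (y ∈ Y ⇔ Sat Φ (y ∷ ρ))
    set-∅ : ∀ e → IsEmpty e → IsSet e
    set-adjoin : ∀ w x y → IsSet x → IsSet y → IsAdjoin w x y → IsSet w
    ind   : ∀ {n} (φ : Fm (suc n)) → SetFm φ →
            (ρ : Vec C n) → All IsSet ρ →
            (∀ e → IsEmpty e → Sat φ (e ∷ ρ)) →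
            (∀ w x y → IsSet x → IsSet y → IsAdjoin w x y →
               Sat φ (x ∷ ρ) → Sat φ (y ∷ ρ) → Sat φ (w ∷ ρ)) →
            ∀ x → IsSet x → Sat φ (x ∷ ρ)
    thin  : ∀ X → Thin X → Semiset X
    comp  : ∀ X u → Thin X → IsSet u → (∀ z → z ∈ u → z ∈⋃ X) →
            Σ C λ x → IsSet x × x ⊆ X × (∀ z → z ∈ u → z ∈⋃ x)

-- Set induction gives collection: if s is a set and every p ∈ s has a set fibre
-- {z : ψ(z, p)} for a set formula ψ, the union of the fibres is a set. With excluded middle,
-- fibres with at most one element are sets, so domains, ranges and {{a} : a ∈ d} of sets are sets.
--
-- Core lemma: let R be a thin class of pairs and d a set of first coordinates of R. Comp applied
-- to {{a} : a ∈ d} ⊆ ⋃R gives a set r ⊆ R still covering d; r is small, so every Z ⊆ d is the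
-- domain of the set {p ∈ r : first coordinate in Z}, and d is small.
-- (1) applies this to the pairs in X. (2) applies it to the converse graph {⟨F a, a⟩ : a ∈ X},
-- whose domain is F``X; it is thin because its elements are determined by their second
-- coordinates, which lie in the thin class X, and its covering set r yields the preimage x.
-- (3): X lies in a set s, and ⋃s is a set.
module Submission where

open import Defs
open import Level using (0ℓ)
open import Axiom.ExcludedMiddle using (ExcludedMiddle)
open import Data.Product using (Σ; _×_; _,_; proj₁; proj₂)
open import Data.Sum using (_⊎_; inj₁; inj₂; [_,_])
open import Data.Sum.Function.Propositional using (_⊎-⇔_)
open import Data.Empty using (⊥; ⊥-elim)
open import Data.Nat using (suc)
open import Data.Fin using (Fin; zero; suc)
open import Data.Vec using (Vec; []; _∷_; lookup)
open import Data.Vec.Relation.Unary.All using (All; []; _∷_)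
open import Relation.Nullary using (yes; no)
open import Relation.Binary.PropositionalEquality using (_≡_; refl; sym; trans; subst; subst₂)
open import Function using (id; _∘_)
open import Function.Bundles using (_⇔_; mk⇔; Equivalence)
open import Function.Construct.Identity using (⇔-id)
open import Function.Construct.Symmetry using (⇔-sym)
open import Function.Related.TypeIsomorphisms using (→-cong-⇔)
open import Data.Product.Function.NonDependent.Propositional using (_×-⇔_)

pattern v0 = zero
pattern v1 = suc v0
pattern v2 = suc v1
pattern v3 = suc v2
pattern v4 = suc v3
pattern v5 = suc v4

liftRen : ∀ {n m} → (Fin n → Fin m) → Fin (suc n) → Fin (suc m)
liftRen f zero    = zero
liftRen f (suc i) = suc (f i)

liftRen-lookup : ∀ {A : Set} {n m} {f : Fin n → Fin m} {σ : Vec A n} {ρ : Vec A m} →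
                 (∀ i → lookup σ i ≡ lookup ρ (f i)) →
                 ∀ x i → lookup (x ∷ σ) i ≡ lookup (x ∷ ρ) (liftRen f i)
liftRen-lookup σ≗ρ∘f x zero    = refl
liftRen-lookup σ≗ρ∘f x (suc i) = σ≗ρ∘f i

rename : ∀ {n m} → (Fin n → Fin m) → Fm n → Fm m
rename f (i ∈' j) = f i ∈' f j
rename f (i ≐ j)  = f i ≐ f j
rename f ⊥'       = ⊥'
rename f (φ ⇒ ψ)  = rename f φ ⇒ rename f ψ
rename f (φ ∧' ψ) = rename f φ ∧' rename f ψ
rename f (φ ∨' ψ) = rename f φ ∨' rename f ψ
rename f (∀c φ)   = ∀c (rename (liftRen f) φ)
rename f (∃c φ)   = ∃c (rename (liftRen f) φ)
rename f (∀s φ)   = ∀s (rename (liftRen f) φ)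
rename f (∃s φ)   = ∃s (rename (liftRen f) φ)

rename-SetFm : ∀ {n m} (f : Fin n → Fin m) (φ : Fm n) → SetFm φ → SetFm (rename f φ)
rename-SetFm f (i ∈' j) _        = _
rename-SetFm f (i ≐ j)  _        = _
rename-SetFm f ⊥'       _        = _
rename-SetFm f (φ ⇒ ψ)  (sφ , sψ) = rename-SetFm f φ sφ , rename-SetFm f ψ sψ
rename-SetFm f (φ ∧' ψ) (sφ , sψ) = rename-SetFm f φ sφ , rename-SetFm f ψ sψ
rename-SetFm f (φ ∨' ψ) (sφ , sψ) = rename-SetFm f φ sφ , rename-SetFm f ψ sψ
rename-SetFm f (∀s φ)   sφ       = rename-SetFm (liftRen f) φ sφ
rename-SetFm f (∃s φ)   sφ       = rename-SetFm (liftRen f) φ sφ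

_⇔'_ : ∀ {n} → Fm n → Fm n → Fm n
φ ⇔' ψ = (φ ⇒ ψ) ∧' (ψ ⇒ φ)

singletonFm : ∀ {n} → Fin n → Fin n → Fm n
singletonFm s a = ∀s ((v0 ∈' suc s) ⇔' (v0 ≐ suc a))

doubletonFm : ∀ {n} → Fin n → Fin n → Fin n → Fm n
doubletonFm s a b = ∀s ((v0 ∈' suc s) ⇔' ((v0 ≐ suc a) ∨' (v0 ≐ suc b)))

pairFm : ∀ {n} → Fin n → Fin n → Fin n → Fm n
pairFm p a b = ∀s ((v0 ∈' suc p) ⇔' (singletonFm v0 (suc a) ∨' doubletonFm v0 (suc a) (suc b)))

-- Induction formula for binary unions, in the variable y: ∀ x. ∃ v. v = x ∪ y.
binaryUnionFm : Fm 1
binaryUnionFm = ∀s (∃s (∀s ((v0 ∈' v1) ⇔' ((v0 ∈' v2) ∨' (v0 ∈' v3)))))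

-- Position of ψ's variables (z, p, ρ) under the binders (z, c, p, s) of setFibresFm.
fibreVars : ∀ {n} → Fin (suc (suc n)) → Fin (suc (suc (suc (suc n))))
fibreVars v0            = v0
fibreVars v1            = v2
fibreVars (suc (suc i)) = suc (suc (suc (suc i)))

-- Position of ψ's variables (z, p, ρ) under the binders (p, z, v, s) of familyUnionFm.
unionVars : ∀ {n} → Fin (suc (suc n)) → Fin (suc (suc (suc (suc n))))
unionVars v0            = v1
unionVars v1            = v0
unionVars (suc (suc i)) = suc (suc (suc (suc i)))

fibreVars-lookup : ∀ {A : Set} {n} (z c p s : A) (ρ : Vec A n) i →
                   lookup (z ∷ p ∷ ρ) i ≡ lookup (z ∷ c ∷ p ∷ s ∷ ρ) (fibreVars i)
fibreVars-lookup z c p s ρ v0            = refl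
fibreVars-lookup z c p s ρ v1            = refl
fibreVars-lookup z c p s ρ (suc (suc i)) = refl

unionVars-lookup : ∀ {A : Set} {n} (p z v s : A) (ρ : Vec A n) i →
                   lookup (z ∷ p ∷ ρ) i ≡ lookup (p ∷ z ∷ v ∷ s ∷ ρ) (unionVars i)
unionVars-lookup p z v s ρ v0            = refl
unionVars-lookup p z v s ρ v1            = refl
unionVars-lookup p z v s ρ (suc (suc i)) = refl

-- In the variable s: ∀ p ∈ s. ∃ c. c = {z : ψ(z, p)}.
setFibresFm : ∀ {n} → Fm (suc (suc n)) → Fm (suc n)
setFibresFm ψ = ∀s ((v0 ∈' v1) ⇒ ∃s (∀s ((v0 ∈' v1) ⇔' rename fibreVars ψ)))

-- In the variable s: ∃ v. v = {z : ∃ p ∈ s. ψ(z, p)}.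
familyUnionFm : ∀ {n} → Fm (suc (suc n)) → Fm (suc n)
familyUnionFm ψ = ∃s (∀s ((v0 ∈' v1) ⇔' ∃s ((v0 ∈' v3) ∧' rename unionVars ψ)))

collectionFm : ∀ {n} → Fm (suc (suc n)) → Fm (suc n)
collectionFm ψ = setFibresFm ψ ⇒ familyUnionFm ψ

collectionFm-SetFm : ∀ {n} (ψ : Fm (suc (suc n))) → SetFm ψ → SetFm (collectionFm ψ)
collectionFm-SetFm ψ sψ = (_ , (_ , fibre) , (fibre , _)) , ((_ , (_ , union)) , ((_ , union) , _))
  where
    fibre : SetFm (rename fibreVars ψ)
    fibre = rename-SetFm fibreVars ψ sψ
    union : SetFm (rename unionVars ψ)
    union = rename-SetFm unionVars ψ sψ

-- ⟨p, a, S⟩ ↦ p ∈ S ∧ ∃ b. p = ⟨b, a⟩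
memberWithSecondFm : Fm 3
memberWithSecondFm = (v0 ∈' v2) ∧' ∃s (pairFm v1 v0 v2)

-- ⟨p, X⟩ ↦ p ∈ X ∧ ∃ a b. p = ⟨a, b⟩
pairMemberFm : Fm 2
pairMemberFm = (v0 ∈' v1) ∧' ∃s (∃s (pairFm v2 v1 v0))

-- ⟨p, r, Z⟩ ↦ p ∈ r ∧ ∃ a b. p = ⟨a, b⟩ ∧ a ∈ Z
firstInFm : Fm 3
firstInFm = (v0 ∈' v1) ∧' ∃s (∃s (pairFm v2 v1 v0 ∧' (v1 ∈' v4)))

-- ⟨p, X, F⟩ ↦ ∃ b a. p = ⟨b, a⟩ ∧ a ∈ X ∧ ⟨a, b⟩ ∈ F
converseGraphFm : Fm 3
converseGraphFm = ∃s (∃s (pairFm v2 v1 v0 ∧' ((v0 ∈' v3) ∧' ∃s (pairFm v0 v1 v2 ∧' (v0 ∈' v5)))))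

-- ⟨a, r, y⟩ ↦ ∃ b ∈ y. ⟨b, a⟩ ∈ r
preimageFm : Fm 3
preimageFm = ∃s ((v0 ∈' v3) ∧' ∃s (pairFm v0 v1 v2 ∧' (v0 ∈' v3)))

module THS₀-Theory (M : THS₀-Model) where
  open THS₀-Model M
  open Notions _∈_
  open Equivalence using (to; from)

  member-isSet : ∀ {z w} → z ∈ w → IsSet z
  member-isSet {w = w} z∈w = w , z∈w

  -- Relativised to set members: this is what ∀s ((v0 ∈' v) ⇔' φ) means under Sat.
  IsClassOf : C → (C → Set) → Set
  IsClassOf v P = ∀ z → IsSet z → (z ∈ v → P z) × (P z → z ∈ v)

  FormsSet : (C → Set) → Set
  FormsSet P = Σ C λ v → IsSet v × IsClassOf v P

  ∈-elim : ∀ {v P z} → IsClassOf v P → z ∈ v → P z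
  ∈-elim v≡P z∈v = proj₁ (v≡P _ (member-isSet z∈v)) z∈v

  ∈-intro : ∀ {v P z} → IsClassOf v P → IsSet z → P z → z ∈ v
  ∈-intro v≡P z-set = proj₂ (v≡P _ z-set)

  ∈⇔ : ∀ {v P z} → IsClassOf v P → IsSet z → z ∈ v ⇔ P z
  ∈⇔ v≡P z-set = mk⇔ (∈-elim v≡P) (∈-intro v≡P z-set)

  classOf-cong : ∀ {v P Q} → (∀ z → IsSet z → P z ⇔ Q z) → IsClassOf v P → IsClassOf v Q
  classOf-cong P⇔Q v≡P z z-set =
    to (P⇔Q z z-set) ∘ ∈-elim v≡P , ∈-intro v≡P z-set ∘ from (P⇔Q z z-set)

  formsSet-cong : ∀ {P Q} → (∀ z → IsSet z → P z ⇔ Q z) → FormsSet P → FormsSet Q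
  formsSet-cong P⇔Q (v , v-set , v≡P) = v , v-set , classOf-cong P⇔Q v≡P

  classOf-restrict : ∀ {v P} → (∀ z → z ∈ v ⇔ P z) → IsClassOf v P
  classOf-restrict v≡P z _ = to (v≡P z) , from (v≡P z)

  classOf-unrestrict : ∀ {v P} → (∀ z → P z → IsSet z) → IsClassOf v P → ∀ z → z ∈ v ⇔ P z
  classOf-unrestrict P-sets v≡P z = mk⇔ (∈-elim v≡P) (λ Pz → ∈-intro v≡P (P-sets z Pz) Pz)

  classOf-unique : ∀ {v w P} → IsClassOf v P → IsClassOf w P → v ≡ w
  classOf-unique {v} {w} v≡P w≡P = ext v w λ z z-set →
    mk⇔ (∈-intro w≡P z-set ∘ ∈-elim v≡P) (∈-intro v≡P z-set ∘ ∈-elim w≡P)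

  ≡⇔classOf : ∀ {s z P} → IsClassOf s P → z ≡ s ⇔ IsClassOf z P
  ≡⇔classOf s≡P = mk⇔ (λ { refl → s≡P }) (λ z≡P → classOf-unique z≡P s≡P)

  classOf-isSet : ∀ {z P} → FormsSet P → IsClassOf z P → IsSet z
  classOf-isSet (v , v-set , v≡P) z≡P = subst IsSet (classOf-unique v≡P z≡P) v-set

  members-formSet⇒isSet : ∀ {Z} → FormsSet (_∈ Z) → IsSet Z
  members-formSet⇒isSet Z-formsSet = classOf-isSet Z-formsSet (λ _ _ → id , id)

  class-exists : ∀ {n} (Φ : Fm (suc n)) (ρ : Vec C n) → Σ C λ Y → IsClassOf Y (λ y → Sat Φ (y ∷ ρ))
  class-exists Φ ρ = let (Y , Y≡Φ) = class Φ ρ in Y , λ y y-set → to (Y≡Φ y y-set) , from (Y≡Φ y y-set)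

  rename-Sat : ∀ {n m} (f : Fin n → Fin m) (φ : Fm n) {σ : Vec C n} {ρ : Vec C m} →
               (∀ i → lookup σ i ≡ lookup ρ (f i)) → Sat φ σ ⇔ Sat (rename f φ) ρ
  rename-Sat-liftRen : ∀ {n m} (f : Fin n → Fin m) (φ : Fm (suc n)) {σ : Vec C n} {ρ : Vec C m} →
                            (∀ i → lookup σ i ≡ lookup ρ (f i)) →
                            ∀ x → Sat φ (x ∷ σ) ⇔ Sat (rename (liftRen f) φ) (x ∷ ρ)

  rename-Sat f (i ∈' j) e = mk⇔ (subst₂ _∈_ (e i) (e j)) (subst₂ _∈_ (sym (e i)) (sym (e j)))
  rename-Sat f (i ≐ j)  e = mk⇔ (λ h → trans (sym (e i)) (trans h (e j)))
                                (λ h → trans (e i) (trans h (sym (e j))))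
  rename-Sat f ⊥'       e = ⇔-id ⊥
  rename-Sat f (φ ⇒ ψ)  e = →-cong-⇔ (rename-Sat f φ e) (rename-Sat f ψ e)
  rename-Sat f (φ ∧' ψ) e = rename-Sat f φ e ×-⇔ rename-Sat f ψ e
  rename-Sat f (φ ∨' ψ) e = rename-Sat f φ e ⊎-⇔ rename-Sat f ψ e
  rename-Sat f (∀c φ)   e = mk⇔ (λ h x → to (rename-Sat-liftRen f φ e x) (h x))
                                (λ h x → from (rename-Sat-liftRen f φ e x) (h x))
  rename-Sat f (∃c φ)   e = mk⇔ (λ (x , h) → x , to (rename-Sat-liftRen f φ e x) h)
                                (λ (x , h) → x , from (rename-Sat-liftRen f φ e x) h)
  rename-Sat f (∀s φ)   e = mk⇔ (λ h x x-set → to (rename-Sat-liftRen f φ e x) (h x x-set))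
                                (λ h x x-set → from (rename-Sat-liftRen f φ e x) (h x x-set))
  rename-Sat f (∃s φ)   e = mk⇔ (λ (x , x-set , h) → x , x-set , to (rename-Sat-liftRen f φ e x) h)
                                (λ (x , x-set , h) → x , x-set , from (rename-Sat-liftRen f φ e x) h)

  rename-Sat-liftRen f φ e x = rename-Sat (liftRen f) φ (liftRen-lookup e x)

  ∅-formsSet : FormsSet (λ _ → ⊥)
  ∅-formsSet with class-exists ⊥' []
  ... | e , e≡∅ = e , set-∅ e (λ _ → ∈-elim e≡∅) , e≡∅

  adjoin-formsSet : ∀ {P y} → FormsSet P → IsSet y → FormsSet (λ z → P z ⊎ z ≡ y)
  adjoin-formsSet {P} {y} (x , x-set , x≡P) y-set
    with class-exists ((v0 ∈' v1) ∨' (v0 ≐ v2)) (x ∷ y ∷ [])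
  ... | w , w≡x∪y = w , set-adjoin w x y x-set y-set w-adjoin , classOf-cong x⇔P w≡x∪y
    where
      w-adjoin : IsAdjoin w x y
      w-adjoin = classOf-unrestrict (λ { z (inj₁ z∈x) → member-isSet z∈x ; z (inj₂ refl) → y-set }) w≡x∪y
      x⇔P : ∀ z → IsSet z → (z ∈ x ⊎ z ≡ y) ⇔ (P z ⊎ z ≡ y)
      x⇔P z z-set = ∈⇔ x≡P z-set ⊎-⇔ ⇔-id _

  singleton-exists : ∀ {a} → IsSet a → FormsSet (_≡ a)
  singleton-exists a-set =
    formsSet-cong (λ _ _ → mk⇔ [ ⊥-elim , id ] inj₂) (adjoin-formsSet ∅-formsSet a-set)

  doubleton-exists : ∀ {a b} → IsSet a → IsSet b → FormsSet (λ z → z ≡ a ⊎ z ≡ b)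
  doubleton-exists a-set = adjoin-formsSet (singleton-exists a-set)

  union-exists : ∀ {x y} → IsSet x → IsSet y → FormsSet (λ z → z ∈ x ⊎ z ∈ y)
  union-exists x-set y-set = ind binaryUnionFm _ [] [] base step _ y-set _ x-set
    where
      base : ∀ e → IsEmpty e → Sat binaryUnionFm (e ∷ [])
      base e e-empty x x-set = x , x-set , λ z _ → inj₁ , [ id , ⊥-elim ∘ e-empty z ]
      step : ∀ w x′ t → IsSet x′ → IsSet t → IsAdjoin w x′ t →
             Sat binaryUnionFm (x′ ∷ []) → Sat binaryUnionFm (t ∷ []) → Sat binaryUnionFm (w ∷ [])
      step w x′ t _ t-set w-adjoin x∪x′ _ x x-set =
        formsSet-cong reassociate (adjoin-formsSet (x∪x′ x x-set) t-set)
        where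
          reassociate : ∀ z → IsSet z → ((z ∈ x ⊎ z ∈ x′) ⊎ z ≡ t) ⇔ (z ∈ x ⊎ z ∈ w)
          reassociate z _ = mk⇔
            [ [ inj₁ , inj₂ ∘ from (w-adjoin z) ∘ inj₁ ] , inj₂ ∘ from (w-adjoin z) ∘ inj₂ ]
            [ inj₁ ∘ inj₁ , [ inj₁ ∘ inj₂ , inj₂ ] ∘ to (w-adjoin z) ]

  union-formsSet : ∀ {P Q} → FormsSet P → FormsSet Q → FormsSet (λ z → P z ⊎ Q z)
  union-formsSet (x , x-set , x≡P) (y , y-set , y≡Q) =
    formsSet-cong (λ z z-set → ∈⇔ x≡P z-set ⊎-⇔ ∈⇔ y≡Q z-set)
                  (union-exists x-set y-set)

  familyUnion-empty : ∀ {R : C → C → Set} {e} → IsEmpty e → IsSet e →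
                      FormsSet (λ z → Σ C λ p → p ∈ e × R p z)
  familyUnion-empty {e = e} e-empty e-set =
    e , e-set , λ z _ → ⊥-elim ∘ e-empty z , λ (p , p∈e , _) → ⊥-elim (e-empty p p∈e)

  familyUnion-adjoin : ∀ {R : C → C → Set} {w x y} → IsAdjoin w x y →
                       FormsSet (λ z → Σ C λ p → p ∈ x × R p z) → FormsSet (R y) →
                       FormsSet (λ z → Σ C λ p → p ∈ w × R p z)
  familyUnion-adjoin {R} {w} {x} {y} w-adjoin ⋃x Ry =
    formsSet-cong (λ z _ → mk⇔ [ enlarge , (λ Ryz → y , from (w-adjoin y) (inj₂ refl) , Ryz) ]
                                (λ (p , p∈w , Rpz) → split (to (w-adjoin p) p∈w) Rpz))
                  (union-formsSet ⋃x Ry)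
    where
      enlarge : ∀ {z} → (Σ C λ p → p ∈ x × R p z) → Σ C λ p → p ∈ w × R p z
      enlarge (p , p∈x , Rpz) = p , from (w-adjoin p) (inj₁ p∈x) , Rpz
      split : ∀ {p z} → p ∈ x ⊎ p ≡ y → R p z → (Σ C λ p → p ∈ x × R p z) ⊎ R y z
      split (inj₁ p∈x) Rpz = inj₁ (_ , p∈x , Rpz)
      split (inj₂ refl) Ryz = inj₂ Ryz

  module _ {n} (ψ : Fm (suc (suc n))) (ρ : Vec C n) where

    setFibres⇔ : ∀ {s} → (∀ p → p ∈ s → FormsSet (λ z → Sat ψ (z ∷ p ∷ ρ))) ⇔ Sat (setFibresFm ψ) (s ∷ ρ)
    setFibres⇔ {s} = mk⇔ (λ fibres p _ p∈s → rename-fibre (fibres p p∈s))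
                         (λ fibres p p∈s → unrename-fibre (fibres p (member-isSet p∈s) p∈s))
      where
        renamed : ∀ z c p → Sat ψ (z ∷ p ∷ ρ) ⇔ Sat (rename fibreVars ψ) (z ∷ c ∷ p ∷ s ∷ ρ)
        renamed z c p = rename-Sat fibreVars ψ (fibreVars-lookup z c p s ρ)
        RenamedFibre : C → Set
        RenamedFibre p = Σ C λ c → IsSet c × IsClassOf c (λ z → Sat (rename fibreVars ψ) (z ∷ c ∷ p ∷ s ∷ ρ))
        rename-fibre : ∀ {p} → FormsSet (λ z → Sat ψ (z ∷ p ∷ ρ)) → RenamedFibre p
        rename-fibre (c , c-set , c≡) = c , c-set , classOf-cong (λ z _ → renamed z c _) c≡
        unrename-fibre : ∀ {p} → RenamedFibre p → FormsSet (λ z → Sat ψ (z ∷ p ∷ ρ))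
        unrename-fibre (c , c-set , c≡) = c , c-set , classOf-cong (λ z _ → ⇔-sym (renamed z c _)) c≡

    familyUnion⇔ : ∀ {s} → FormsSet (λ z → Σ C λ p → p ∈ s × Sat ψ (z ∷ p ∷ ρ)) ⇔ Sat (familyUnionFm ψ) (s ∷ ρ)
    familyUnion⇔ {s} = mk⇔
      (λ (v , v-set , v≡) → v , v-set , classOf-cong (λ z _ → mk⇔
         (λ (p , p∈s , h) → p , member-isSet p∈s , p∈s , to (renamed p z v) h)
         (λ (p , _ , p∈s , h) → p , p∈s , from (renamed p z v) h)) v≡)
      (λ (v , v-set , v≡) → v , v-set , classOf-cong (λ z _ → mk⇔
         (λ (p , _ , p∈s , h) → p , p∈s , from (renamed p z v) h)
         (λ (p , p∈s , h) → p , member-isSet p∈s , p∈s , to (renamed p z v) h)) v≡)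
      where
        renamed : ∀ p z v → Sat ψ (z ∷ p ∷ ρ) ⇔ Sat (rename unionVars ψ) (p ∷ z ∷ v ∷ s ∷ ρ)
        renamed p z v = rename-Sat unionVars ψ (unionVars-lookup p z v s ρ)

    collection : SetFm ψ → All IsSet ρ → ∀ {s} → IsSet s →
                 (∀ p → p ∈ s → FormsSet (λ z → Sat ψ (z ∷ p ∷ ρ))) →
                 FormsSet (λ z → Σ C λ p → p ∈ s × Sat ψ (z ∷ p ∷ ρ))
    collection ψ-set ρ-sets {s} s-set fibres =
      from familyUnion⇔ (ind (collectionFm ψ) (collectionFm-SetFm ψ ψ-set) ρ ρ-sets base step
                              s s-set (to setFibres⇔ fibres))
      where
        base : ∀ e → IsEmpty e → Sat (collectionFm ψ) (e ∷ ρ)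
        base e e-empty _ = to familyUnion⇔ (familyUnion-empty e-empty (set-∅ e e-empty))
        step : ∀ w x y → IsSet x → IsSet y → IsAdjoin w x y →
               Sat (collectionFm ψ) (x ∷ ρ) → Sat (collectionFm ψ) (y ∷ ρ) → Sat (collectionFm ψ) (w ∷ ρ)
        step w x y _ _ w-adjoin ⋃x _ w-fibres =
          to familyUnion⇔ (familyUnion-adjoin w-adjoin
            (from familyUnion⇔ (⋃x (to setFibres⇔ λ p p∈x → fibres-w p (from (w-adjoin p) (inj₁ p∈x)))))
            (fibres-w y (from (w-adjoin y) (inj₂ refl))))
          where
            fibres-w : ∀ p → p ∈ w → FormsSet (λ z → Sat ψ (z ∷ p ∷ ρ))
            fibres-w = from setFibres⇔ w-fibres

  ⋃-formsSet : ∀ {s} → IsSet s → FormsSet (λ z → Σ C λ w → w ∈ s × z ∈ w)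
  ⋃-formsSet s-set = collection (v0 ∈' v1) [] _ [] s-set λ w w∈s → w , member-isSet w∈s , λ _ _ → id , id

  SetSingleton : C → C → Set
  SetSingleton s a = IsClassOf s (_≡ a)

  SetDoubleton : C → C → C → Set
  SetDoubleton s a b = IsClassOf s (λ z → z ≡ a ⊎ z ≡ b)

  -- Definitionally the meaning of pairFm.
  SetPair : C → C → C → Set
  SetPair p a b = IsClassOf p (λ z → SetSingleton z a ⊎ SetDoubleton z a b)

  IsOrderedPair : C → Set
  IsOrderedPair p = Σ C λ a → IsSet a × Σ C λ b → IsSet b × SetPair p a b

  HasSecond : C → C → Set
  HasSecond p a = Σ C λ b → IsSet b × SetPair p b a

  SetPairIn : C → C → C → Set
  SetPairIn a b R = Σ C λ p → IsSet p × SetPair p a b × p ∈ R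

  pair-exists : ∀ {a b} → IsSet a → IsSet b → Σ C λ p → IsSet p × SetPair p a b
  pair-exists a-set b-set
    with singleton-exists a-set | doubleton-exists a-set b-set
  ... | s , s-set , s≡⁅a⁆ | d , d-set , d≡⁅a,b⁆ =
    formsSet-cong (λ _ _ → ≡⇔classOf s≡⁅a⁆ ⊎-⇔ ≡⇔classOf d≡⁅a,b⁆) (doubleton-exists s-set d-set)

  pair-member-contains-first : ∀ {p a b w} → SetPair p a b → IsSet a → w ∈ p → a ∈ w
  pair-member-contains-first p≡ab a-set w∈p with ∈-elim p≡ab w∈p
  ... | inj₁ w≡⁅a⁆   = ∈-intro w≡⁅a⁆ a-set refl
  ... | inj₂ w≡⁅a,b⁆ = ∈-intro w≡⁅a,b⁆ a-set (inj₁ refl)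

  pair-member-members : ∀ {p a b w z} → SetPair p a b → w ∈ p → z ∈ w → z ≡ a ⊎ z ≡ b
  pair-member-members p≡ab w∈p z∈w with ∈-elim p≡ab w∈p
  ... | inj₁ w≡⁅a⁆   = inj₁ (∈-elim w≡⁅a⁆ z∈w)
  ... | inj₂ w≡⁅a,b⁆ = ∈-elim w≡⁅a,b⁆ z∈w

  setPair-injectiveˡ : ∀ {p a b a′ b′} → IsSet a → IsSet a′ → SetPair p a b → SetPair p a′ b′ → a ≡ a′
  setPair-injectiveˡ a-set a′-set p≡ab p≡a′b′ with singleton-exists a-set
  ... | s , s-set , s≡⁅a⁆ =
    sym (∈-elim s≡⁅a⁆ (pair-member-contains-first p≡a′b′ a′-set (∈-intro p≡ab s-set (inj₁ s≡⁅a⁆))))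

  setPair-injectiveʳ : ∀ {p a b b′} → IsSet a → IsSet b → IsSet b′ → SetPair p a b → SetPair p a b′ → b ≡ b′
  setPair-injectiveʳ {p} {a} a-set b-set b′-set p≡ab p≡ab′ =
    same-second (second-in p≡ab p≡ab′ b-set) (second-in p≡ab′ p≡ab b′-set)
    where
      second-in : ∀ {c c′} → SetPair p a c → SetPair p a c′ → IsSet c → c ≡ a ⊎ c ≡ c′
      second-in p≡ac p≡ac′ c-set with doubleton-exists a-set c-set
      ... | d , d-set , d≡⁅a,c⁆ =
        pair-member-members p≡ac′ (∈-intro p≡ac d-set (inj₂ d≡⁅a,c⁆)) (∈-intro d≡⁅a,c⁆ c-set (inj₂ refl))
      same-second : ∀ {b b′} → b ≡ a ⊎ b ≡ b′ → b′ ≡ a ⊎ b′ ≡ b → b ≡ b′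
      same-second (inj₂ b≡b′) _            = b≡b′
      same-second (inj₁ _)    (inj₂ b′≡b)  = sym b′≡b
      same-second (inj₁ b≡a)  (inj₁ b′≡a)  = trans b≡a (sym b′≡a)

  setPair-injective : ∀ {p a b a′ b′} → IsSet a → IsSet b → IsSet a′ → IsSet b′ →
                      SetPair p a b → SetPair p a′ b′ → a ≡ a′ × b ≡ b′
  setPair-injective a-set b-set a′-set b′-set p≡ab p≡a′b′
    with setPair-injectiveˡ a-set a′-set p≡ab p≡a′b′
  ... | refl = refl , setPair-injectiveʳ a-set b-set b′-set p≡ab p≡a′b′

  setPair⇔isPair : ∀ {p a b} → IsSet a → IsSet b → SetPair p a b ⇔ IsPair p a b
  setPair⇔isPair {a = a} {b} a-set b-set = mk⇔
    (classOf-unrestrict components-are-sets ∘ classOf-cong (λ _ _ → components⇔))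
    (classOf-cong (λ _ _ → ⇔-sym components⇔) ∘ classOf-restrict)
    where
      components⇔ : ∀ {z} → (SetSingleton z a ⊎ SetDoubleton z a b) ⇔ (IsSingleton z a ⊎ IsDoubleton z a b)
      components⇔ =
        mk⇔ (classOf-unrestrict λ { _ refl → a-set }) classOf-restrict ⊎-⇔
        mk⇔ (classOf-unrestrict λ { _ (inj₁ refl) → a-set ; _ (inj₂ refl) → b-set }) classOf-restrict
      components-are-sets : ∀ z → IsSingleton z a ⊎ IsDoubleton z a b → IsSet z
      components-are-sets z (inj₁ z≡⁅a⁆)   = classOf-isSet (singleton-exists a-set) (classOf-restrict z≡⁅a⁆)
      components-are-sets z (inj₂ z≡⁅a,b⁆) = classOf-isSet (doubleton-exists a-set b-set) (classOf-restrict z≡⁅a,b⁆)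

  setPairIn⇔pairIn : ∀ {a b R} → IsSet a → IsSet b → SetPairIn a b R ⇔ PairIn a b R
  setPairIn⇔pairIn a-set b-set = mk⇔
    (λ (p , _ , p≡ab , p∈R) → p , to (setPair⇔isPair a-set b-set) p≡ab , p∈R)
    (λ (p , p≡ab , p∈R) → p , member-isSet p∈R , from (setPair⇔isPair a-set b-set) p≡ab , p∈R)

  setPairIn-⊆ : ∀ {a b r R} → r ⊆ R → SetPairIn a b r → SetPairIn a b R
  setPairIn-⊆ r⊆R (p , p-set , p≡ab , p∈r) = p , p-set , p≡ab , r⊆R p p∈r

  IsRelation : C → Set
  IsRelation R = ∀ p → p ∈ R → IsOrderedPair p

  SetFunctional : C → Set
  SetFunctional F = ∀ {a b b′} → IsSet a → IsSet b → IsSet b′ → SetPairIn a b F → SetPairIn a b′ F → b ≡ b′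

  isFunction⇒setFunctional : ∀ {F} → IsFunction F → SetFunctional F
  isFunction⇒setFunctional (_ , single-valued) a-set b-set b′-set ab∈F ab′∈F =
    single-valued _ _ _ a-set b-set b′-set
      (to (setPairIn⇔pairIn a-set b-set) ab∈F) (to (setPairIn⇔pairIn a-set b′-set) ab′∈F)

  DeterminedBySecond : C → Set
  DeterminedBySecond R = ∀ {p q a b b′} → IsSet a → IsSet b → IsSet b′ →
                         p ∈ R → q ∈ R → SetPair p b a → SetPair q b′ a → p ≡ q

  _⊆dom_ : C → C → Set
  d ⊆dom R = ∀ a → a ∈ d → Σ C λ b → IsSet b × SetPairIn a b R

  thin-⊆ : ∀ {X Y} → Thin X → Y ⊆ X → Thin Y
  thin-⊆ X-thin Y⊆X y y-set y⊆Y = X-thin y y-set (λ z z∈y → Y⊆X z (y⊆Y z z∈y))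

  singleton∈⋃ : ∀ {a b R S} → SetPairIn a b R → IsSet S → SetSingleton S a → S ∈⋃ R
  singleton∈⋃ (p , _ , p≡ab , p∈R) S-set S≡⁅a⁆ = p , ∈-intro p≡ab S-set (inj₁ S≡⁅a⁆) , p∈R

  pair-with-singleton-member : ∀ {R w a S} → IsRelation R → w ∈ R → IsSet a → SetSingleton S a → S ∈ w →
                               Σ C λ b → IsSet b × SetPair w a b
  pair-with-singleton-member R-rel w∈R a-set S≡⁅a⁆ S∈w with R-rel _ w∈R
  ... | c , c-set , b , b-set , w≡cb with ∈-elim S≡⁅a⁆ (pair-member-contains-first w≡cb c-set S∈w)
  ... | refl = b , b-set , w≡cb

  union-semiset : ∀ {X U} → Thin X → IsUnion U X → Semiset U
  union-semiset {X} X-thin U≡⋃X with thin X X-thin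
  ... | s , s-set , X⊆s with ⋃-formsSet s-set
  ... | V , V-set , V≡⋃s = V , V-set , λ z z∈U →
    let (w , z∈w , w∈X) = to (U≡⋃X z) z∈U in ∈-intro V≡⋃s (member-isSet z∈w) (w , X⊆s w w∈X , z∈w)

  module WithExcludedMiddle (em : ExcludedMiddle 0ℓ) where

    subsingleton-formsSet : ∀ {P : C → Set} → (∀ {z z′} → IsSet z → IsSet z′ → P z → P z′ → z ≡ z′) → FormsSet P
    subsingleton-formsSet {P} unique with em {Σ C λ z → IsSet z × P z}
    ... | yes (z , z-set , Pz) =
      formsSet-cong (λ w w-set → mk⇔ (λ { refl → Pz }) (λ Pw → unique w-set z-set Pw Pz)) (singleton-exists z-set)
    ... | no ¬P = formsSet-cong (λ w w-set → mk⇔ ⊥-elim (λ Pw → ¬P (w , w-set , Pw))) ∅-formsSet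

    replacement : ∀ {n} (ψ : Fm (suc (suc n))) → SetFm ψ → (ρ : Vec C n) → All IsSet ρ → ∀ {s} → IsSet s →
                  (∀ {p z z′} → p ∈ s → IsSet z → IsSet z′ → Sat ψ (z ∷ p ∷ ρ) → Sat ψ (z′ ∷ p ∷ ρ) → z ≡ z′) →
                  FormsSet (λ z → Σ C λ p → p ∈ s × Sat ψ (z ∷ p ∷ ρ))
    replacement ψ ψ-set ρ ρ-sets s-set functional =
      collection ψ ρ ψ-set ρ-sets s-set (λ p p∈s → subsingleton-formsSet (functional p∈s))

    domain-formsSet : ∀ {s} → IsSet s → FormsSet (λ a → Σ C λ p → p ∈ s × Σ C λ b → IsSet b × SetPair p a b)
    domain-formsSet s-set = replacement (∃s (pairFm v2 v1 v0)) _ [] [] s-set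
      λ _ a-set a′-set (_ , _ , p≡ab) (_ , _ , p≡a′b′) → setPair-injectiveˡ a-set a′-set p≡ab p≡a′b′

    range-formsSet : ∀ {s} → IsSet s → FormsSet (λ b → Σ C λ p → p ∈ s × Σ C λ a → IsSet a × SetPair p a b)
    range-formsSet s-set = replacement (∃s (pairFm v2 v0 v1)) _ [] [] s-set
      λ _ b-set b′-set (_ , a-set , p≡ab) (_ , a′-set , p≡a′b′) →
        proj₂ (setPair-injective a-set b-set a′-set b′-set p≡ab p≡a′b′)

    singletons-formsSet : ∀ {d} → IsSet d → FormsSet (λ S → Σ C λ a → a ∈ d × SetSingleton S a)
    singletons-formsSet d-set = replacement (singletonFm v0 v1) _ [] [] d-set
      λ _ _ _ S≡⁅a⁆ S′≡⁅a⁆ → classOf-unique S≡⁅a⁆ S′≡⁅a⁆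

    covering-pairs : ∀ {R d} → Thin R → IsRelation R → IsSet d → d ⊆dom R →
                     Σ C λ r → IsSet r × r ⊆ R × d ⊆dom r
    covering-pairs {R} {d} R-thin R-rel d-set d⊆domR =
      let (u , u-set , u≡⁅⁅d⁆⁆) = singletons-formsSet d-set
          u⊆⋃R : ∀ S → S ∈ u → S ∈⋃ R
          u⊆⋃R S S∈u =
            let (a , a∈d , S≡⁅a⁆) = ∈-elim u≡⁅⁅d⁆⁆ S∈u
                (_ , _ , ab∈R) = d⊆domR a a∈d
            in singleton∈⋃ ab∈R (member-isSet S∈u) S≡⁅a⁆
          (r , r-set , r⊆R , u⊆⋃r) = comp R u R-thin u-set u⊆⋃R
          d⊆domr : d ⊆dom r
          d⊆domr a a∈d =
            let a-set = member-isSet a∈d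
                (S , S-set , S≡⁅a⁆) = singleton-exists a-set
                (w , S∈w , w∈r) = u⊆⋃r S (∈-intro u≡⁅⁅d⁆⁆ S-set (a , a∈d , S≡⁅a⁆))
                (b , b-set , w≡ab) = pair-with-singleton-member R-rel (r⊆R w w∈r) a-set S≡⁅a⁆ S∈w
            in b , b-set , w , member-isSet w∈r , w≡ab , w∈r
      in r , r-set , r⊆R , d⊆domr

    -- Z is the domain of {p ∈ r : first coordinate in Z}, a subclass of r.
    dom-small-of-small : ∀ {r d} → Small r → d ⊆dom r → Small d
    dom-small-of-small {r} r-small d⊆domr Z Z⊆d =
      let (r↾Z , r↾Z≡) = class-exists firstInFm (r ∷ Z ∷ [])
          r↾Z-set : IsSet r↾Z
          r↾Z-set = r-small r↾Z (λ p p∈r↾Z → proj₁ (∈-elim r↾Z≡ p∈r↾Z))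
          dom⇔Z : ∀ a → IsSet a → (Σ C λ p → p ∈ r↾Z × Σ C λ b → IsSet b × SetPair p a b) ⇔ a ∈ Z
          dom⇔Z a a-set = mk⇔
            (λ (p , p∈r↾Z , _ , _ , p≡ab) →
               let (_ , a′ , a′-set , _ , _ , p≡a′b′ , a′∈Z) = ∈-elim r↾Z≡ p∈r↾Z
               in subst (_∈ Z) (setPair-injectiveˡ a′-set a-set p≡a′b′ p≡ab) a′∈Z)
            (λ a∈Z →
               let (b , b-set , p , p-set , p≡ab , p∈r) = d⊆domr a (Z⊆d a a∈Z)
               in p , ∈-intro r↾Z≡ p-set (p∈r , a , a-set , b , b-set , p≡ab , a∈Z) , b , b-set , p≡ab)
      in members-formSet⇒isSet (formsSet-cong dom⇔Z (domain-formsSet r↾Z-set))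

    dom-small-of-thin : ∀ {R d} → Thin R → IsRelation R → IsSet d → d ⊆dom R → Small d
    dom-small-of-thin R-thin R-rel d-set d⊆domR =
      let (r , r-set , r⊆R , d⊆domr) = covering-pairs R-thin R-rel d-set d⊆domR
      in dom-small-of-small (R-thin r r-set r⊆R) d⊆domr

    -- Z is the image of its set B of second coordinates under a ↦ the p ∈ t with second coordinate a.
    determinedBySecond-isSet : ∀ {R t Z} → IsRelation R → DeterminedBySecond R → IsSet t → t ⊆ R → Z ⊆ t →
                               FormsSet (λ a → Σ C λ p → IsSet p × p ∈ Z × HasSecond p a) → IsSet Z
    determinedBySecond-isSet {t = t} {Z} R-rel R-determined t-set t⊆R Z⊆t (B , B-set , B≡seconds) =
      members-formSet⇒isSet (formsSet-cong image⇔Z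
        (replacement memberWithSecondFm _ (t ∷ []) (t-set ∷ []) B-set unique))
      where
        unique : ∀ {a z z′} → a ∈ B → IsSet z → IsSet z′ →
                 z ∈ t × HasSecond z a → z′ ∈ t × HasSecond z′ a → z ≡ z′
        unique a∈B _ _ (z∈t , b , b-set , z≡ba) (z′∈t , b′ , b′-set , z′≡b′a) =
          R-determined (member-isSet a∈B) b-set b′-set (t⊆R _ z∈t) (t⊆R _ z′∈t) z≡ba z′≡b′a
        image⇔Z : ∀ z → IsSet z → (Σ C λ a → a ∈ B × z ∈ t × HasSecond z a) ⇔ z ∈ Z
        image⇔Z z z-set = mk⇔
          (λ (a , a∈B , z∈t , z-second) →
             let (p , _ , p∈Z , p-second) = ∈-elim B≡seconds a∈B
             in subst (_∈ Z) (unique a∈B (member-isSet p∈Z) z-set (Z⊆t p p∈Z , p-second) (z∈t , z-second)) p∈Z)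
          (λ z∈Z →
             let (b , b-set , a , a-set , z≡ba) = R-rel z (t⊆R z (Z⊆t z z∈Z))
             in a , ∈-intro B≡seconds a-set (z , z-set , z∈Z , b , b-set , z≡ba) , Z⊆t z z∈Z , b , b-set , z≡ba)

    determinedBySecond-thin : ∀ {R T} → Thin T → IsRelation R → DeterminedBySecond R →
                              (∀ {a b} → IsSet a → IsSet b → SetPairIn b a R → a ∈ T) → Thin R
    determinedBySecond-thin {T = T} T-thin R-rel R-determined ran⊆T t t-set t⊆R Z Z⊆t =
      let (A , A-set , A≡ran) = range-formsSet t-set
          (B , B≡seconds) = class-exists (∃s memberWithSecondFm) (Z ∷ [])
          A⊆T : A ⊆ T
          A⊆T a a∈A = let (p , p∈t , b , b-set , p≡ba) = ∈-elim A≡ran a∈A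
                      in ran⊆T (member-isSet a∈A) b-set (p , member-isSet p∈t , p≡ba , t⊆R p p∈t)
          B⊆A : B ⊆ A
          B⊆A a a∈B = let (p , _ , p∈Z , b , b-set , p≡ba) = ∈-elim B≡seconds a∈B
                      in ∈-intro A≡ran (member-isSet a∈B) (p , Z⊆t p p∈Z , b , b-set , p≡ba)
      in determinedBySecond-isSet R-rel R-determined t-set t⊆R Z⊆t (B , T-thin A A-set A⊆T B B⊆A , B≡seconds)

    domain-thin : ∀ {X D} → Thin X → IsDom D X → Thin D
    domain-thin {X} X-thin D≡domX d d-set d⊆D =
      let (R , R≡pairs) = class-exists pairMemberFm (X ∷ [])
          d⊆domR : d ⊆dom R
          d⊆domR a a∈d =
            let a-set = member-isSet a∈d
                (b , b-set , ab∈X) = to (D≡domX a a-set) (d⊆D a a∈d)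
                (p , p-set , p≡ab , p∈X) = from (setPairIn⇔pairIn a-set b-set) ab∈X
            in b , b-set , p , p-set , p≡ab , ∈-intro R≡pairs p-set (p∈X , a , a-set , b , b-set , p≡ab)
      in dom-small-of-thin (thin-⊆ X-thin (λ p p∈R → proj₁ (∈-elim R≡pairs p∈R)))
                           (λ p p∈R → proj₂ (∈-elim R≡pairs p∈R)) d-set d⊆domR

    module ConverseGraph {X F Q} (X-thin : Thin X) (F-functional : SetFunctional F)
                         (Q≡ : IsClassOf Q (λ p → Sat converseGraphFm (p ∷ X ∷ F ∷ []))) where

      converseGraph-pairIn : ∀ {a b} → IsSet b → IsSet a → SetPairIn b a Q → a ∈ X × SetPairIn a b F
      converseGraph-pairIn b-set a-set (p , _ , p≡ba , p∈Q) with ∈-elim Q≡ p∈Q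
      ... | b₀ , b₀-set , a₀ , a₀-set , p≡b₀a₀ , a₀∈X , a₀b₀∈F
        with setPair-injective b₀-set a₀-set b-set a-set p≡b₀a₀ p≡ba
      ... | refl , refl = a₀∈X , a₀b₀∈F

      converseGraph-relation : IsRelation Q
      converseGraph-relation p p∈Q = let (b , b-set , a , a-set , p≡ba , _) = ∈-elim Q≡ p∈Q
                                     in b , b-set , a , a-set , p≡ba

      converseGraph-determinedBySecond : DeterminedBySecond Q
      converseGraph-determinedBySecond {p} {q} a-set b-set b′-set p∈Q q∈Q p≡ba q≡b′a
        with F-functional a-set b-set b′-set
               (proj₂ (converseGraph-pairIn b-set a-set (p , member-isSet p∈Q , p≡ba , p∈Q)))
               (proj₂ (converseGraph-pairIn b′-set a-set (q , member-isSet q∈Q , q≡b′a , q∈Q)))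
      ... | refl = classOf-unique p≡ba q≡b′a

      converseGraph-thin : Thin Q
      converseGraph-thin = determinedBySecond-thin X-thin converseGraph-relation converseGraph-determinedBySecond
        (λ a-set b-set ba∈Q → proj₁ (converseGraph-pairIn b-set a-set ba∈Q))

      image⊆dom : ∀ {I y} → IsImage I F X → y ⊆ I → y ⊆dom Q
      image⊆dom I≡FX y⊆I b b∈y =
        let b-set = member-isSet b∈y
            (a , a∈X , a-set , ab∈F) = to (I≡FX b b-set) (y⊆I b b∈y)
            (p , p-set , p≡ba) = pair-exists b-set a-set
        in a , a-set , p , p-set , p≡ba ,
           ∈-intro Q≡ p-set (b , b-set , a , a-set , p≡ba , a∈X , from (setPairIn⇔pairIn a-set b-set) ab∈F)

      image-thin : ∀ {I} → IsImage I F X → Thin I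
      image-thin I≡FX y y-set y⊆I =
        dom-small-of-thin converseGraph-thin converseGraph-relation y-set (image⊆dom I≡FX y⊆I)

      -- x := {a : ∃ b ∈ y. ⟨b, a⟩ ∈ r} lies in the range of r, a set contained in the thin class X.
      preimage-of-covering : ∀ {r y} → IsSet r → r ⊆ Q → y ⊆dom r → Σ C λ x → IsSet x × x ⊆ X × IsImage y F x
      preimage-of-covering {r} {y} r-set r⊆Q y⊆domr =
        let (A , A-set , A≡ran) = range-formsSet r-set
            (x , x≡) = class-exists preimageFm (r ∷ y ∷ [])
            A⊆X : A ⊆ X
            A⊆X a a∈A = let (p , p∈r , b , b-set , p≡ba) = ∈-elim A≡ran a∈A
                        in proj₁ (converseGraph-pairIn b-set (member-isSet a∈A)
                                    (p , member-isSet p∈r , p≡ba , r⊆Q p p∈r))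
            x⊆A : x ⊆ A
            x⊆A a a∈x = let (b , b-set , _ , p , _ , p≡ba , p∈r) = ∈-elim x≡ a∈x
                        in ∈-intro A≡ran (member-isSet a∈x) (p , p∈r , b , b-set , p≡ba)
            x-image : IsImage y F x
            x-image b b-set = mk⇔
              (λ b∈y → let (a , a-set , ba∈r) = y⊆domr b b∈y
                           ab∈F = proj₂ (converseGraph-pairIn b-set a-set (setPairIn-⊆ r⊆Q ba∈r))
                       in a , ∈-intro x≡ a-set (b , b-set , b∈y , ba∈r) , a-set ,
                          to (setPairIn⇔pairIn a-set b-set) ab∈F)
              (λ (a , a∈x , a-set , ab∈F) →
                 let (b′ , b′-set , b′∈y , b′a∈r) = ∈-elim x≡ a∈x
                     ab′∈F = proj₂ (converseGraph-pairIn b′-set a-set (setPairIn-⊆ r⊆Q b′a∈r))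
                 in subst (_∈ y) (F-functional a-set b′-set b-set ab′∈F
                                                (from (setPairIn⇔pairIn a-set b-set) ab∈F)) b′∈y)
        in x , X-thin A A-set A⊆X x x⊆A , (λ a a∈x → A⊆X a (x⊆A a a∈x)) , x-image

      image-preimage : ∀ {I y} → IsImage I F X → IsSet y → y ⊆ I → Σ C λ x → IsSet x × x ⊆ X × IsImage y F x
      image-preimage I≡FX y-set y⊆I =
        let (r , r-set , r⊆Q , y⊆domr) =
              covering-pairs converseGraph-thin converseGraph-relation y-set (image⊆dom I≡FX y⊆I)
        in preimage-of-covering r-set r⊆Q y⊆domr

    image-thin : ∀ {X F I} → Thin X → IsFunction F → IsImage I F X → Thin I
    image-thin {X} {F} X-thin F-function =
      ConverseGraph.image-thin X-thin (isFunction⇒setFunctional F-function)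
                                      (proj₂ (class-exists converseGraphFm (X ∷ F ∷ [])))

    image-preimage : ∀ {X F I y} → Thin X → IsFunction F → IsImage I F X → IsSet y → y ⊆ I →
                     Σ C λ x → IsSet x × x ⊆ X × IsImage y F x
    image-preimage {X} {F} X-thin F-function =
      ConverseGraph.image-preimage X-thin (isFunction⇒setFunctional F-function)
                                          (proj₂ (class-exists converseGraphFm (X ∷ F ∷ [])))

proposition6 : ExcludedMiddle 0ℓ → (M : THS₀-Model) →
    let open THS₀-Model M in
    let open Notions _∈_ in
    ∀ X → Thin X →
      (∀ D → IsDom D X → Thin D) ×
      (∀ F → IsFunction F →
         ∀ I → IsImage I F X →
           Thin I ×
           (∀ y → IsSet y → y ⊆ I →
              Σ C λ x → IsSet x × x ⊆ X × IsImage y F x)) ×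
      (∀ U → IsUnion U X → Semiset U)
proposition6 em M X X-thin =
  (λ D → domain-thin X-thin) ,
  (λ F F-function I I≡FX → image-thin X-thin F-function I≡FX ,
                           λ y y-set y⊆I → image-preimage X-thin F-function I≡FX y-set y⊆I) ,
  (λ U → union-semiset X-thin)
  where
    open THS₀-Theory M
    open WithExcludedMiddle em
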